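{- Let $n$ be a positive integer. The minimum distance and the stopping distance of the binary code $\mathcal{C}(n,2)$ (with respect to the parity-check matrix $H(n,2)$) are both $2^{\frac{n(n+1)}{2}}$.
   Context: $\mathbb{S}_n(\mathbb{F}_2)$ denotes the set of $n\times n$ symmetric matrices over $\mathbb{F}_2$ (its elements are called points). Two points $S,S'$ are adjacent if $\operatorname{rank}(S-S')=1$. A line is a maximal set of rank $1$: a subset $\mathcal{M}\subseteq\mathbb{S}_n(\mathbb{F}_2)$ such that any two distinct points of $\mathcal{M}$ are adjacent and no point outside $\mathcal{M}$ is adjacent to every point of $\mathcal{M}$. $H(n,2)$ is the binary matrix with rows indexed by the lines and columns indexed by the points, whose (line, point) entry is $1$ iff the point belongs to the line. $\mathcal{C}(n,2)=\{c\in\mathbb{F}_2^{\text{points}}: H(n,2)c=0\}$. A stopping set is a set $T$ of coordinate positions such that no row of $H(n,2)$ has exactly one $1$ among the positions in $T$; the stopping distance is the minimum size of a nonempty stopping set. -}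

module Defs where

open import Data.Bool using (Bool; true; false; _∧_; _xor_; if_then_else_)
open import Data.Nat using (ℕ; zero; suc; _+_; _*_; _^_; _<_; _≤_; _/_; _%_)
open import Data.Fin using (Fin)
open import Data.Vec using (Vec; []; _∷_; lookup; zipWith)
open import Data.List using (List; []; _∷_; map; concatMap; filter; length; foldr; allFin)
open import Data.Product using (Σ; ∃; _×_; _,_)
open import Relation.Nullary using (¬_)
open import Relation.Binary.PropositionalEquality using (_≡_; _≢_)
open import Relation.Nullary.Decidable using (T?)
open import Data.Bool using (T)

-- n×n matrices over F₂ (Bool with xor as addition, ∧ as multiplication)
Mat : ℕ → Set
Mat n = Vec (Vec Bool n) n

entry : {n : ℕ} → Mat n → Fin n → Fin n → Bool
entry M i j = lookup (lookup M i) j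

xorSum : List Bool → Bool
xorSum = foldr _xor_ false

allVecs : {A : Set} → List A → (m : ℕ) → List (Vec A m)
allVecs xs zero = [] ∷ []
allVecs xs (suc m) = concatMap (λ x → map (x ∷_) (allVecs xs m)) xs

allMats : (n : ℕ) → List (Mat n)
allMats n = allVecs (allVecs (true ∷ false ∷ []) n) n

_==_ : Bool → Bool → Bool
a == b = not (a xor b)
  where
  not : Bool → Bool
  not true = false
  not false = true

allL : {A : Set} → (A → Bool) → List A → Bool
allL p = foldr (λ x b → p x ∧ b) true

isSym : {n : ℕ} → Mat n → Bool
isSym {n} M = allL (λ i → allL (λ j → entry M i j == entry M j i) (allFin n)) (allFin n)

_-M_ : {n : ℕ} → Mat n → Mat n → Mat n
S -M S' = zipWith (zipWith _xor_) S S'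

FactorsThrough : {n : ℕ} → Mat n → ℕ → Set
FactorsThrough {n} M k =
  Σ (Fin n → Fin k → Bool) λ A → Σ (Fin k → Fin n → Bool) λ B →
    ∀ i j → entry M i j ≡ xorSum (map (λ l → A i l ∧ B l j) (allFin k))

HasRank : {n : ℕ} → Mat n → ℕ → Set
HasRank M r = FactorsThrough M r × (∀ k → k < r → ¬ FactorsThrough M k)

Adjacent : {n : ℕ} → Mat n → Mat n → Set
Adjacent S S' = HasRank (S -M S') 1

-- A subset of points is given by a Bool predicate; its members are the
-- symmetric matrices on which it is true.
Subset : ℕ → Set
Subset n = Mat n → Bool

Member : {n : ℕ} → Subset n → Mat n → Set
Member L M = T (isSym M ∧ L M)

size : {n : ℕ} → Subset n → ℕ
size {n} L = length (filter (λ M → T? (isSym M ∧ L M)) (allMats n))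

_∩_ : {n : ℕ} → Subset n → Subset n → Subset n
(A ∩ B) M = A M ∧ B M

IsLine : {n : ℕ} → Subset n → Set
IsLine {n} L =
  (∀ P Q → Member L P → Member L Q → P ≢ Q → Adjacent P Q) ×
  (∀ R → T (isSym R) → ¬ Member L R → ¬ (∀ P → Member L P → Adjacent R P))

-- codewords c ∈ F₂^points (values off the symmetric matrices are ignored);
-- membership in C(n,2): H(n,2) c = 0, i.e. every line meets supp(c) evenly
InCode : {n : ℕ} → Subset n → Set
InCode {n} c = ∀ L → IsLine L → size (L ∩ c) % 2 ≡ 0

weight : {n : ℕ} → Subset n → ℕ
weight = size

IsStoppingSet : {n : ℕ} → Subset n → Set
IsStoppingSet {n} S = ∀ L → IsLine L → size (L ∩ S) ≢ 1

MinDistance : ℕ → ℕ → Set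
MinDistance n d =
  (Σ (Subset n) λ c → InCode c × 0 < weight c × weight c ≡ d) ×
  (∀ (c : Subset n) → InCode c → 0 < weight c → d ≤ weight c)

StoppingDistance : ℕ → ℕ → Set
StoppingDistance n d =
  (Σ (Subset n) λ S → IsStoppingSet S × 0 < size S × size S ≡ d) ×
  (∀ (S : Subset n) → IsStoppingSet S → 0 < size S → d ≤ size S)

-- Over F₂ a symmetric matrix of rank one is x xᵀ for a nonzero vector x, and x xᵀ + y yᵀ is never of
-- this form; so no three points are pairwise adjacent and the lines are exactly the pairs of adjacent
-- points. Every line thus meets the set of all points twice, which makes that set both a codeword and
-- a stopping set. Conversely, a stopping set containing Q contains every neighbour Q + x xᵀ (else the
-- line through the two would meet it once), and such steps connect any two symmetric matrices; so
-- every nonempty stopping set, in particular the support of every nonzero codeword, consists of all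
-- 2^(n(n+1)/2) points.
module Submission where

open import Defs
open import Data.Bool using (Bool; true; false; _∧_; _∨_; _xor_; not; T)
open import Data.Bool.Properties
  using (T-∧; T-∨; ∧-comm; ∧-idem; ∧-identityʳ; ∧-zeroʳ; ∧-conicalˡ; ∧-conicalʳ;
         xor-assoc; xor-comm; xor-same; xor-identityʳ; ¬-not)
  renaming (_≟_ to _≟ᵇ_)
open import Data.Empty using (⊥; ⊥-elim)
open import Data.Fin using (Fin; zero; suc)
open import Data.Fin.Properties using (any?)
open import Data.List
  using (List; []; _∷_; _++_; map; allFin; filter; length; concatMap; cartesianProductWith; cartesianProduct)
open import Data.List.Properties using (length-++; length-map)
open import Data.List.Membership.Propositional using (_∈_; find; lose)
open import Data.List.Membership.Propositional.Properties
  using (∈-filter⁺; ∈-filter⁻; ∈-allFin; ∈-cartesianProductWith⁺; ∈-cartesianProductWith⁻;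
         ∈-cartesianProduct⁺; ∈-cartesianProduct⁻)
open import Data.List.Membership.Propositional.Properties.WithK using (unique∧set⇒bag)
open import Data.List.Relation.Binary.BagAndSetEquality using (∼bag⇒↭)
open import Data.List.Relation.Binary.Permutation.Propositional.Properties using (↭-length)
import Data.List.Relation.Unary.Any as Any
open import Data.List.Relation.Unary.Any using (here; there)
import Data.List.Relation.Unary.All as All
open import Data.List.Relation.Unary.All using (All; []; _∷_)
open import Data.List.Relation.Unary.Unique.Propositional using (Unique; []; _∷_)
import Data.List.Relation.Unary.Unique.Propositional.Properties as Unique
open import Data.Nat using (ℕ; zero; suc; _+_; _*_; _^_; _/_; _%_; _<_; _≤_; z≤n; s≤s)
open import Data.Nat.DivMod using (m*n/n≡m)
open import Data.Nat.Properties using (^-distribˡ-+-*; *-distribʳ-+; ≤-reflexive; m^n>0)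
open import Data.Nat.Solver using (module +-*-Solver)
open import Data.Product using (Σ-syntax; ∃; ∃₂; _×_; _,_; proj₁; proj₂; uncurry)
open import Data.Sum using (_⊎_; inj₁; inj₂)
import Data.Sum as Sum
open import Data.Vec using (Vec; []; _∷_; lookup; tabulate; zipWith)
open import Data.Vec.Functional using () renaming (_∷_ to _∷ᶠ_)
open import Data.Vec.Properties
  using (∷-injective; zipWith-comm; lookup-zipWith; lookup∘tabulate; tabulate∘lookup; tabulate-cong; ≡-dec)
open import Function using (_∘_; _⇔_; mk⇔; Equivalence)
import Function.Properties.Equivalence as ⇔
open import Relation.Nullary using (¬_; Dec; yes; no; contradiction; ¬?; _×-dec_)
open import Relation.Nullary.Decidable using (T?; ⌊_⌋; toWitness; fromWitness)
open import Relation.Binary.PropositionalEquality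
  using (_≡_; _≢_; refl; sym; trans; cong; cong₂; subst; module ≡-Reasoning)

open Equivalence using (to; from)

private variable
  n : ℕ
  A B C : Set

-- Enumerations and counting

length-cartesianProductWith : (f : A → B → C) (xs : List A) (ys : List B) →
  length (cartesianProductWith f xs ys) ≡ length xs * length ys
length-cartesianProductWith f [] ys = refl
length-cartesianProductWith f (x ∷ xs) ys =
  trans (length-++ (map (f x) ys)) (cong₂ _+_ (length-map (f x) ys) (length-cartesianProductWith f xs ys))

concatMap≡cartesianProductWith : (f : A → B → C) (xs : List A) (ys : List B) →
  concatMap (λ x → map (f x) ys) xs ≡ cartesianProductWith f xs ys
concatMap≡cartesianProductWith f [] ys = refl
concatMap≡cartesianProductWith f (x ∷ xs) ys = cong (map (f x) ys ++_) (concatMap≡cartesianProductWith f xs ys)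

allVecs-suc : (xs : List A) (m : ℕ) → allVecs xs (suc m) ≡ cartesianProductWith _∷_ xs (allVecs xs m)
allVecs-suc xs m = concatMap≡cartesianProductWith _∷_ xs (allVecs xs m)

allVecs-unique : {xs : List A} (m : ℕ) → Unique xs → Unique (allVecs xs m)
allVecs-unique zero u = [] ∷ []
allVecs-unique {xs = xs} (suc m) u rewrite allVecs-suc xs m =
  Unique.cartesianProductWith⁺ _∷_ ∷-injective u (allVecs-unique m u)

∈-allVecs : {xs : List A} → (∀ a → a ∈ xs) → {m : ℕ} (v : Vec A m) → v ∈ allVecs xs m
∈-allVecs all∈ [] = here refl
∈-allVecs {xs = xs} all∈ {suc m} (a ∷ v) rewrite allVecs-suc xs m =
  ∈-cartesianProductWith⁺ _∷_ (all∈ a) (∈-allVecs all∈ v)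

length-allVecs : (xs : List A) (m : ℕ) → length (allVecs xs m) ≡ length xs ^ m
length-allVecs xs zero = refl
length-allVecs xs (suc m) rewrite allVecs-suc xs m =
  trans (length-cartesianProductWith _∷_ xs (allVecs xs m)) (cong (length xs *_) (length-allVecs xs m))

bools : List Bool
bools = true ∷ false ∷ []

bools-unique : Unique bools
bools-unique = ((λ ()) ∷ []) ∷ [] ∷ []

∈-bools : ∀ b → b ∈ bools
∈-bools true = here refl
∈-bools false = there (here refl)

allMats-unique : (n : ℕ) → Unique (allMats n)
allMats-unique n = allVecs-unique n (allVecs-unique n bools-unique)

∈-allMats : (M : Mat n) → M ∈ allMats n
∈-allMats = ∈-allVecs (∈-allVecs ∈-bools)

member? : (c : Subset n) (M : Mat n) → Dec (Member c M)
member? c M = T? (isSym M ∧ c M)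

members : Subset n → List (Mat n)
members {n} c = filter (member? c) (allMats n)

∈-members : (c : Subset n) {M : Mat n} → M ∈ members c ⇔ Member c M
∈-members {n} c =
  mk⇔ (λ M∈ → proj₂ (∈-filter⁻ (member? c) {xs = allMats n} M∈)) (∈-filter⁺ (member? c) (∈-allMats _))

size-≡-length : (c : Subset n) {ys : List (Mat n)} → Unique ys →
  (∀ {M} → M ∈ ys ⇔ Member c M) → size c ≡ length ys
size-≡-length {n} c ys-unique ys≈c = ↭-length (∼bag⇒↭ (unique∧set⇒bag
  (Unique.filter⁺ _ (allMats-unique n)) ys-unique (⇔.trans (∈-members c) (⇔.sym ys≈c))))

positive-size⇒member : (c : Subset n) → 0 < size c → ∃ (Member c)
positive-size⇒member c 0<size with members c in eq
... | M ∷ _ = M , to (∈-members c) (subst (M ∈_) (sym eq) (here refl))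

search : {P : Mat n → Set} → (∀ M → Dec (P M)) → ∃ P ⊎ (∀ M → ¬ P M)
search {n} P? with Any.any? P? (allMats n)
... | yes found = inj₁ (let M , _ , PM = find found in M , PM)
... | no none = inj₂ (λ M PM → none (lose (∈-allMats M) PM))

-- Symmetric matrices and rank one

T-allL : (p : A → Bool) (xs : List A) → T (allL p xs) ⇔ All (T ∘ p) xs
T-allL p [] = mk⇔ (λ _ → []) (λ _ → _)
T-allL p (x ∷ xs) = mk⇔
  (λ t → let px , rest = to T-∧ t in px ∷ to (T-allL p xs) rest)
  (λ { (px ∷ rest) → from T-∧ (px , from (T-allL p xs) rest) })

T-== : ∀ a b → T (a == b) ⇔ a ≡ b
T-== true true = mk⇔ (λ _ → refl) _
T-== true false = mk⇔ (λ ()) (λ ())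
T-== false true = mk⇔ (λ ()) (λ ())
T-== false false = mk⇔ (λ _ → refl) _

Sym : Mat n → Set
Sym M = ∀ i j → entry M i j ≡ entry M j i

isSym⇔Sym : (M : Mat n) → T (isSym M) ⇔ Sym M
isSym⇔Sym {n} M = mk⇔
  (λ t i j → to (T-== _ _) (All.lookup (to (T-allL (sym-at i) (allFin n))
                 (All.lookup (to (T-allL sym-row (allFin n)) t) (∈-allFin i))) (∈-allFin j)))
  (λ s → from (T-allL sym-row (allFin n)) (All.tabulate λ {i} _ →
           from (T-allL (sym-at i) (allFin n)) (All.tabulate λ {j} _ → from (T-== _ _) (s i j))))
  where
  sym-at : Fin n → Fin n → Bool
  sym-at i j = entry M i j == entry M j i
  sym-row : Fin n → Bool
  sym-row i = allL (sym-at i) (allFin n)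

member⇒Sym : {c : Subset n} {M : Mat n} → Member c M → Sym M
member⇒Sym {M = M} m = to (isSym⇔Sym M) (proj₁ (to T-∧ m))

member⇒T : {c : Subset n} {M : Mat n} → Member c M → T (c M)
member⇒T m = proj₂ (to T-∧ m)

mkMember : {c : Subset n} {M : Mat n} → Sym M → T (c M) → Member c M
mkMember {M = M} s t = from T-∧ (from (isSym⇔Sym M) s , t)

matrix : (Fin n → Fin n → Bool) → Mat n
matrix f = tabulate λ i → tabulate (f i)

entry-matrix : (f : Fin n → Fin n → Bool) (i j : Fin n) → entry (matrix f) i j ≡ f i j
entry-matrix f i j rewrite lookup∘tabulate (λ i → tabulate (f i)) i = lookup∘tabulate (f i) j

vec-ext : {xs ys : Vec A n} → (∀ i → lookup xs i ≡ lookup ys i) → xs ≡ ys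
vec-ext {xs = xs} {ys} h = trans (sym (tabulate∘lookup xs)) (trans (tabulate-cong h) (tabulate∘lookup ys))

mat-ext : {M N : Mat n} → (∀ i j → entry M i j ≡ entry N i j) → M ≡ N
mat-ext h = vec-ext λ i → vec-ext (h i)

entry-−M : (M N : Mat n) (i j : Fin n) → entry (M -M N) i j ≡ entry M i j xor entry N i j
entry-−M M N i j rewrite lookup-zipWith (zipWith _xor_) i M N = lookup-zipWith _xor_ j (lookup M i) (lookup N i)

xor-cancelˡ : ∀ a b → a xor (a xor b) ≡ b
xor-cancelˡ a b = trans (sym (xor-assoc a a b)) (cong (_xor b) (xor-same a))

-M-comm : (M N : Mat n) → M -M N ≡ N -M M
-M-comm = zipWith-comm (zipWith-comm xor-comm)

-M-cancelˡ : (M N : Mat n) → M -M (M -M N) ≡ N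
-M-cancelˡ M N = mat-ext λ i j → begin
  entry (M -M (M -M N)) i j                     ≡⟨ entry-−M M (M -M N) i j ⟩
  entry M i j xor entry (M -M N) i j            ≡⟨ cong (entry M i j xor_) (entry-−M M N i j) ⟩
  entry M i j xor (entry M i j xor entry N i j) ≡⟨ xor-cancelˡ (entry M i j) (entry N i j) ⟩
  entry N i j                                   ∎
  where open ≡-Reasoning

xor-telescope : ∀ a b c → (a xor b) xor (b xor c) ≡ a xor c
xor-telescope a b c = trans (xor-assoc a b (b xor c)) (cong (a xor_) (xor-cancelˡ b c))

-M-telescope : (L M N : Mat n) → (L -M M) -M (M -M N) ≡ L -M N
-M-telescope L M N = mat-ext λ i j → begin
  entry ((L -M M) -M (M -M N)) i j          ≡⟨ entry-−M (L -M M) (M -M N) i j ⟩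
  entry (L -M M) i j xor entry (M -M N) i j ≡⟨ cong₂ _xor_ (entry-−M L M i j) (entry-−M M N i j) ⟩
  _                                         ≡⟨ xor-telescope (entry L i j) (entry M i j) (entry N i j) ⟩
  entry L i j xor entry N i j               ≡⟨ entry-−M L N i j ⟨
  entry (L -M N) i j                        ∎
  where open ≡-Reasoning

Sym-−M : {M N : Mat n} → Sym M → Sym N → Sym (M -M N)
Sym-−M {M = M} {N} sM sN i j =
  trans (entry-−M M N i j) (trans (cong₂ _xor_ (sM i j) (sN i j)) (sym (entry-−M M N j i)))

outer : (Fin n → Bool) → Mat n
outer x = matrix λ i j → x i ∧ x j

Sym-outer : (x : Fin n → Bool) → Sym (outer x)
Sym-outer x i j = trans (entry-matrix _ i j) (trans (∧-comm (x i) (x j)) (sym (entry-matrix _ j i)))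

entry-−outer : (M : Mat n) (x : Fin n → Bool) (i j : Fin n) →
  entry (M -M outer x) i j ≡ entry M i j xor (x i ∧ x j)
entry-−outer M x i j = trans (entry-−M M (outer x) i j) (cong (entry M i j xor_) (entry-matrix _ i j))

Nonzero : (Fin n → Bool) → Set
Nonzero x = ∃ λ i → x i ≡ true

outer-hasRank-1 : {x : Fin n → Bool} → Nonzero x → HasRank (outer x) 1
outer-hasRank-1 {x = x} (i , xᵢ) = ((λ k _ → x k) , (λ _ l → x l) , factor) , not-zero
  where
  factor : ∀ k l → entry (outer x) k l ≡ (x k ∧ x l) xor false
  factor k l = trans (entry-matrix _ k l) (sym (xor-identityʳ _))
  not-zero : ∀ k → k < 1 → ¬ FactorsThrough (outer x) k
  not-zero zero _ (_ , _ , zero-factor) =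
    contradiction (trans (sym (cong₂ _∧_ xᵢ xᵢ)) (trans (sym (entry-matrix _ i i)) (zero-factor i i))) λ ()
  not-zero (suc _) (s≤s ()) _

nonzero-entry : (D : Mat n) → ¬ FactorsThrough D 0 → ∃₂ λ i j → entry D i j ≡ true
nonzero-entry D D≢0 with any? (λ i → any? (λ j → entry D i j ≟ᵇ true))
... | yes (i , j , Dᵢⱼ) = i , j , Dᵢⱼ
... | no none = contradiction ((λ _ ()) , (λ ()) , λ i j → ¬-not (λ Dᵢⱼ → none (i , j , Dᵢⱼ))) D≢0

-- Symmetry forces the two factors of a rank-one matrix to coincide: a k = D k j = D j k = b k.
symmetric-rank-1 : {D : Mat n} → Sym D → HasRank D 1 → ∃ λ x → Nonzero x × D ≡ outer x
symmetric-rank-1 {D = D} D-sym ((a′ , b′ , D≡a′b′) , minimal) with nonzero-entry D (minimal 0 (s≤s z≤n))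
... | i , j , Dᵢⱼ = a , (i , aᵢ) , mat-ext λ k l → begin
  entry D k l     ≡⟨ D≡ab k l ⟩
  a k ∧ b l       ≡⟨ cong (a k ∧_) (a≡b l) ⟨
  a k ∧ a l       ≡⟨ entry-matrix _ k l ⟨
  entry (outer a) k l ∎
  where
  open ≡-Reasoning
  a b : Fin _ → Bool
  a k = a′ k zero
  b l = b′ zero l
  D≡ab : ∀ k l → entry D k l ≡ a k ∧ b l
  D≡ab k l = trans (D≡a′b′ k l) (xor-identityʳ _)
  aᵢ : a i ≡ true
  aᵢ = ∧-conicalˡ _ _ (trans (sym (D≡ab i j)) Dᵢⱼ)
  bⱼ : b j ≡ true
  bⱼ = ∧-conicalʳ _ _ (trans (sym (D≡ab i j)) Dᵢⱼ)
  aⱼ : a j ≡ true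
  aⱼ = ∧-conicalˡ _ _ (trans (sym (D≡ab j i)) (trans (D-sym j i) Dᵢⱼ))
  a≡b : ∀ k → a k ≡ b k
  a≡b k = begin
    a k         ≡⟨ ∧-identityʳ (a k) ⟨
    a k ∧ true  ≡⟨ cong (a k ∧_) bⱼ ⟨
    a k ∧ b j   ≡⟨ trans (sym (D≡ab k j)) (trans (D-sym k j) (D≡ab j k)) ⟩
    a j ∧ b k   ≡⟨ cong (_∧ b k) aⱼ ⟩
    b k         ∎

-- x xᵀ + y yᵀ = z zᵀ forces z = x + y on the diagonal, and then y = 0 or z = 0 along a row where
-- x is nonzero.
outer-sum-not-outer : {x y z : Fin n → Bool} → Nonzero x → Nonzero y → Nonzero z → outer x -M outer y ≢ outer z
outer-sum-not-outer {x = x} {y} {z} (i , xᵢ) (j , yⱼ) (k , zₖ) sum≡ = split (y i) refl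
  where
  open ≡-Reasoning
  entries : ∀ a b → (x a ∧ x b) xor (y a ∧ y b) ≡ z a ∧ z b
  entries a b = begin
    (x a ∧ x b) xor (y a ∧ y b)                    ≡⟨ cong₂ _xor_ (entry-matrix _ a b) (entry-matrix _ a b) ⟨
    entry (outer x) a b xor entry (outer y) a b    ≡⟨ entry-−M (outer x) (outer y) a b ⟨
    entry (outer x -M outer y) a b                 ≡⟨ cong (λ M → entry M a b) sum≡ ⟩
    entry (outer z) a b                            ≡⟨ entry-matrix _ a b ⟩
    z a ∧ z b                                      ∎
  diagonal : ∀ a → x a xor y a ≡ z a
  diagonal a = trans (cong₂ _xor_ (sym (∧-idem (x a))) (sym (∧-idem (y a)))) (trans (entries a a) (∧-idem (z a)))
  row : ∀ b → x b xor (y i ∧ y b) ≡ z i ∧ z b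
  row b = trans (cong (λ t → (t ∧ x b) xor (y i ∧ y b)) (sym xᵢ)) (entries i b)
  zᵢ : z i ≡ not (y i)
  zᵢ = trans (sym (diagonal i)) (cong (_xor y i) xᵢ)
  split : ∀ t → y i ≡ t → ⊥
  split false yᵢ = contradiction (trans (sym yⱼ) yⱼ≡false) λ ()
    where
    rowⱼ : x j xor false ≡ z j
    rowⱼ = trans (cong (λ t → x j xor (t ∧ y j)) (sym yᵢ)) (trans (row j) (cong (_∧ z j) (trans zᵢ (cong not yᵢ))))
    yⱼ≡false : y j ≡ false
    yⱼ≡false = begin
      y j                     ≡⟨ xor-cancelˡ (x j) (y j) ⟨
      x j xor (x j xor y j)   ≡⟨ cong (x j xor_) (trans (diagonal j) (sym rowⱼ)) ⟩
      x j xor (x j xor false) ≡⟨ xor-cancelˡ (x j) false ⟩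
      false                   ∎
  split true yᵢ = contradiction (trans (sym zₖ) (trans (sym (diagonal k)) rowₖ)) λ ()
    where
    rowₖ : x k xor y k ≡ false
    rowₖ = trans (cong (λ t → x k xor (t ∧ y k)) (sym yᵢ)) (trans (row k) (cong (_∧ z k) (trans zᵢ (cong not yᵢ))))

-- The adjacency graph and its lines

adjacent-sym : {P Q : Mat n} → Adjacent P Q → Adjacent Q P
adjacent-sym {P = P} {Q} = subst (λ D → HasRank D 1) (-M-comm P Q)

adjacent-outer : (Q : Mat n) {x : Fin n → Bool} → Nonzero x → Adjacent Q (Q -M outer x)
adjacent-outer Q {x} x≢0 = subst (λ D → HasRank D 1) (sym (-M-cancelˡ Q (outer x))) (outer-hasRank-1 x≢0)

no-triangle : {L M N : Mat n} → Sym L → Sym M → Sym N →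
  Adjacent L M → Adjacent M N → Adjacent L N → ⊥
no-triangle {L = L} {M} {N} L-sym M-sym N-sym LM MN LN
  with symmetric-rank-1 (Sym-−M {M = L} {M} L-sym M-sym) LM
     | symmetric-rank-1 (Sym-−M {M = M} {N} M-sym N-sym) MN
     | symmetric-rank-1 (Sym-−M {M = L} {N} L-sym N-sym) LN
... | x , x≢0 , L-M≡x | y , y≢0 , M-N≡y | z , z≢0 , L-N≡z =
  outer-sum-not-outer x≢0 y≢0 z≢0 (begin
    outer x -M outer y      ≡⟨ cong₂ _-M_ L-M≡x M-N≡y ⟨
    (L -M M) -M (M -M N)    ≡⟨ -M-telescope L M N ⟩
    L -M N                  ≡⟨ L-N≡z ⟩
    outer z                 ∎)
  where open ≡-Reasoning

_≟ᴹ_ : (M N : Mat n) → Dec (M ≡ N)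
_≟ᴹ_ = ≡-dec (≡-dec _≟ᵇ_)

pair : Mat n → Mat n → Subset n
pair P Q M = ⌊ M ≟ᴹ P ⌋ ∨ ⌊ M ≟ᴹ Q ⌋

T-pair : (P Q M : Mat n) → T (pair P Q M) ⇔ (M ≡ P ⊎ M ≡ Q)
T-pair P Q M = mk⇔
  (Sum.map (toWitness {a? = M ≟ᴹ P}) (toWitness {a? = M ≟ᴹ Q}) ∘ to T-∨)
  (from T-∨ ∘ Sum.map (fromWitness {a? = M ≟ᴹ P}) (fromWitness {a? = M ≟ᴹ Q}))

pair-isLine : {P Q : Mat n} → Sym P → Sym Q → Adjacent P Q → IsLine (pair P Q)
pair-isLine {P = P} {Q} P-sym Q-sym PQ = pairwise , maximal
  where
  pairwise : ∀ A B → Member (pair P Q) A → Member (pair P Q) B → A ≢ B → Adjacent A B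
  pairwise A B A∈ B∈ A≢B
    with to (T-pair P Q A) (member⇒T {c = pair P Q} {A} A∈) | to (T-pair P Q B) (member⇒T {c = pair P Q} {B} B∈)
  ... | inj₁ refl | inj₁ refl = contradiction refl A≢B
  ... | inj₁ refl | inj₂ refl = PQ
  ... | inj₂ refl | inj₁ refl = adjacent-sym {P = P} PQ
  ... | inj₂ refl | inj₂ refl = contradiction refl A≢B
  maximal : ∀ R → T (isSym R) → ¬ Member (pair P Q) R → ¬ (∀ A → Member (pair P Q) A → Adjacent R A)
  maximal R R-sym _ R∼all = no-triangle {L = R} {P} {Q} (to (isSym⇔Sym R) R-sym) P-sym Q-sym
    (R∼all P (mkMember {c = pair P Q} {P} P-sym (from (T-pair P Q P) (inj₁ refl)))) PQ
    (R∼all Q (mkMember {c = pair P Q} {Q} Q-sym (from (T-pair P Q Q) (inj₂ refl))))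

full : Subset n
full _ = true

Member-∩-full : (c : Subset n) (M : Mat n) → Member (c ∩ full) M ⇔ Member c M
Member-∩-full c M = mk⇔ (subst (λ b → T (isSym M ∧ b)) (∧-identityʳ (c M)))
                        (subst (λ b → T (isSym M ∧ b)) (sym (∧-identityʳ (c M))))

module _ {m : ℕ} {L : Subset (suc m)} (L-line : IsLine L) where

  private
    pairwise = proj₁ L-line
    maximal = proj₂ L-line

  line-nonempty : ∃ (Member L)
  line-nonempty with search (member? L)
  ... | inj₁ found = found
  ... | inj₂ none = contradiction (λ P P∈ → contradiction P∈ (none P))
    (maximal O (from (isSym⇔Sym O) O-sym) (none O))
    where
    O : Mat (suc m)
    O = matrix λ _ _ → false
    O-sym : Sym O
    O-sym i j = trans (entry-matrix (λ _ _ → false) i j) (sym (entry-matrix (λ _ _ → false) j i))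

  -- P + 𝟙𝟙ᵀ is adjacent to P, so by maximality L cannot be {P}.
  line-second-point : {P : Mat (suc m)} → Member L P → ∃ λ Q → Member L Q × P ≢ Q
  line-second-point {P} P∈ with search (λ Q → member? L Q ×-dec ¬? (P ≟ᴹ Q))
  ... | inj₁ (Q , Q∈ , P≢Q) = Q , Q∈ , P≢Q
  ... | inj₂ none = contradiction R∼all (maximal R (from (isSym⇔Sym R) R-sym) R∉L)
    where
    𝟙 : Fin (suc m) → Bool
    𝟙 _ = true
    R = P -M outer 𝟙
    R-sym : Sym R
    R-sym = Sym-−M {M = P} (member⇒Sym {c = L} {P} P∈) (Sym-outer 𝟙)
    P≢R : P ≢ R
    P≢R P≡R =
      flip-≢ (entry P zero zero) (trans (cong (λ M → entry M zero zero) P≡R) (entry-−outer P 𝟙 zero zero))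
      where
      flip-≢ : ∀ b → b ≢ b xor true
      flip-≢ true ()
      flip-≢ false ()
    R∉L : ¬ Member L R
    R∉L R∈ = none R (R∈ , P≢R)
    R∼all : ∀ A → Member L A → Adjacent R A
    R∼all A A∈ with P ≟ᴹ A
    ... | yes refl = adjacent-sym {P = P} (adjacent-outer P {𝟙} (zero , refl))
    ... | no P≢A = contradiction (A∈ , P≢A) (none A)

  line-size : size (L ∩ full) ≡ 2
  line-size = size-≡-length (L ∩ full) ((P≢Q ∷ []) ∷ [] ∷ []) (mk⇔ listed⇒member member⇒listed)
    where
    P = proj₁ line-nonempty
    P∈ = proj₂ line-nonempty
    Q = proj₁ (line-second-point P∈)
    Q∈ = proj₁ (proj₂ (line-second-point P∈))
    P≢Q = proj₂ (proj₂ (line-second-point P∈))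
    listed⇒member : ∀ {M} → M ∈ P ∷ Q ∷ [] → Member (L ∩ full) M
    listed⇒member (here refl) = from (Member-∩-full L P) P∈
    listed⇒member (there (here refl)) = from (Member-∩-full L Q) Q∈
    member⇒listed : ∀ {M} → Member (L ∩ full) M → M ∈ P ∷ Q ∷ []
    member⇒listed {M} M∈ with M ≟ᴹ P | M ≟ᴹ Q
    ... | yes refl | _ = here refl
    ... | no _ | yes refl = there (here refl)
    ... | no M≢P | no M≢Q = ⊥-elim (no-triangle {L = M} {P} {Q} M-sym P-sym Q-sym
      (pairwise M P M∈L P∈ M≢P) (pairwise P Q P∈ Q∈ P≢Q) (pairwise M Q M∈L Q∈ M≢Q))
      where
      M∈L = to (Member-∩-full L M) M∈
      M-sym = member⇒Sym {c = L} {M} M∈L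
      P-sym = member⇒Sym {c = L} {P} P∈
      Q-sym = member⇒Sym {c = L} {Q} Q∈

full-isCodeword : InCode (full {suc n})
full-isCodeword L L-line = cong (_% 2) (line-size L-line)

full-isStoppingSet : IsStoppingSet (full {suc n})
full-isStoppingSet L L-line size≡1 = contradiction (trans (sym (line-size L-line)) size≡1) λ ()

codeword⇒stoppingSet : {c : Subset n} → InCode c → IsStoppingSet c
codeword⇒stoppingSet c∈C L L-line size≡1 = contradiction (trans (sym (cong (_% 2) size≡1)) (c∈C L L-line)) λ ()

-- Otherwise the line {Q, Q'} would meet S in the single point Q.
stoppingSet-adjacent : {S : Subset n} → IsStoppingSet S → {Q Q′ : Mat n} → Sym Q′ →
  Adjacent Q Q′ → Member S Q → Member S Q′
stoppingSet-adjacent {S = S} S-stop {Q} {Q′} Q′-sym QQ′ Q∈ with T? (S Q′)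
... | yes Q′∈S = mkMember {c = S} {Q′} Q′-sym Q′∈S
... | no Q′∉S = contradiction meets-once (S-stop (pair Q Q′) (pair-isLine Q-sym Q′-sym QQ′))
  where
  Q-sym = member⇒Sym {c = S} {Q} Q∈
  meets-once : size (pair Q Q′ ∩ S) ≡ 1
  meets-once = size-≡-length (pair Q Q′ ∩ S) ([] ∷ []) (mk⇔ listed⇒member member⇒listed)
    where
    listed⇒member : ∀ {M} → M ∈ Q ∷ [] → Member (pair Q Q′ ∩ S) M
    listed⇒member (here refl) = mkMember {c = pair Q Q′ ∩ S} {Q} Q-sym
      (from T-∧ (from (T-pair Q Q′ Q) (inj₁ refl) , member⇒T {c = S} {Q} Q∈))
    member⇒listed : ∀ {M} → Member (pair Q Q′ ∩ S) M → M ∈ Q ∷ []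
    member⇒listed {M} M∈ with to T-∧ (member⇒T {c = pair Q Q′ ∩ S} {M} M∈)
    ... | M∈pair , M∈S with to (T-pair Q Q′ M) M∈pair
    ... | inj₁ refl = here refl
    ... | inj₂ refl = contradiction M∈S Q′∉S

-- Bordered matrices and connectivity

bordered : Bool → Vec Bool n → Mat n → Mat (suc n)
bordered b v S = (b ∷ v) ∷ zipWith _∷_ v S

entry-bordered-suc-zero : (b : Bool) (v : Vec Bool n) (S : Mat n) (i : Fin n) →
  entry (bordered b v S) (suc i) zero ≡ lookup v i
entry-bordered-suc-zero b v S i = cong (λ row → lookup row zero) (lookup-zipWith _∷_ i v S)

entry-bordered-suc-suc : (b : Bool) (v : Vec Bool n) (S : Mat n) (i j : Fin n) →
  entry (bordered b v S) (suc i) (suc j) ≡ entry S i j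
entry-bordered-suc-suc b v S i j = cong (λ row → lookup row (suc j)) (lookup-zipWith _∷_ i v S)

bordered-ext : {M : Mat (suc n)} {b : Bool} {v : Vec Bool n} {S : Mat n} →
  entry M zero zero ≡ b →
  (∀ j → entry M zero (suc j) ≡ lookup v j) →
  (∀ i → entry M (suc i) zero ≡ lookup v i) →
  (∀ i j → entry M (suc i) (suc j) ≡ entry S i j) →
  M ≡ bordered b v S
bordered-ext {b = b} {v} {S} corner top left inner = mat-ext λ where
  zero zero → corner
  zero (suc j) → top j
  (suc i) zero → trans (left i) (sym (entry-bordered-suc-zero b v S i))
  (suc i) (suc j) → trans (inner i j) (sym (entry-bordered-suc-suc b v S i j))

minor : Mat (suc n) → Mat n
minor M = matrix λ i j → entry M (suc i) (suc j)

firstRow : Mat (suc n) → Vec Bool n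
firstRow M = tabulate λ j → entry M zero (suc j)

bordered-decomposition : (M : Mat (suc n)) → Sym M → M ≡ bordered (entry M zero zero) (firstRow M) (minor M)
bordered-decomposition M M-sym = bordered-ext refl
  (λ j → sym (lookup∘tabulate _ j))
  (λ i → trans (M-sym (suc i) zero) (sym (lookup∘tabulate _ i)))
  (λ i j → sym (entry-matrix _ i j))

minor-bordered : (b : Bool) (v : Vec Bool n) (S : Mat n) → minor (bordered b v S) ≡ S
minor-bordered b v S = mat-ext λ i j → trans (entry-matrix _ i j) (entry-bordered-suc-suc b v S i j)

Sym-minor : {M : Mat (suc n)} → Sym M → Sym (minor M)
Sym-minor {M = M} M-sym i j = trans (entry-matrix _ i j) (trans (M-sym (suc i) (suc j)) (sym (entry-matrix _ j i)))

Sym-bordered : (b : Bool) (v : Vec Bool n) {S : Mat n} → Sym S → Sym (bordered b v S)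
Sym-bordered b v {S} S-sym zero zero = refl
Sym-bordered b v {S} S-sym zero (suc j) = sym (entry-bordered-suc-zero b v S j)
Sym-bordered b v {S} S-sym (suc i) zero = entry-bordered-suc-zero b v S i
Sym-bordered b v {S} S-sym (suc i) (suc j) =
  trans (entry-bordered-suc-suc b v S i j) (trans (S-sym i j) (sym (entry-bordered-suc-suc b v S j i)))

bordered-−outer-false : (b : Bool) (v : Vec Bool n) (S : Mat n) (y : Fin n → Bool) →
  bordered b v S -M outer (false ∷ᶠ y) ≡ bordered b v (S -M outer y)
bordered-−outer-false b v S y = bordered-ext
  (trans (entry-−outer (bordered b v S) x zero zero) (xor-identityʳ b))
  (λ j → trans (entry-−outer (bordered b v S) x zero (suc j)) (xor-identityʳ (lookup v j)))
  (λ i → trans (entry-−outer (bordered b v S) x (suc i) zero)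
                (trans (cong₂ _xor_ (entry-bordered-suc-zero b v S i) (∧-zeroʳ (y i))) (xor-identityʳ (lookup v i))))
  (λ i j → trans (entry-−outer (bordered b v S) x (suc i) (suc j))
                  (trans (cong (_xor (y i ∧ y j)) (entry-bordered-suc-suc b v S i j)) (sym (entry-−outer S y i j))))
  where
  x = false ∷ᶠ y

bordered-−outer-true : (b : Bool) (v w : Vec Bool n) (S : Mat n) →
  let δ = λ i → lookup v i xor lookup w i in
  bordered b v S -M outer (true ∷ᶠ δ) ≡ bordered (not b) w (S -M outer δ)
bordered-−outer-true b v w S = bordered-ext
  (trans (entry-−outer (bordered b v S) x zero zero) (xor-comm b true))
  (λ j → trans (entry-−outer (bordered b v S) x zero (suc j)) (xor-cancelˡ (lookup v j) (lookup w j)))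
  (λ i → trans (entry-−outer (bordered b v S) x (suc i) zero)
                (trans (cong₂ _xor_ (entry-bordered-suc-zero b v S i) (∧-identityʳ (δ i)))
                       (xor-cancelˡ (lookup v i) (lookup w i))))
  (λ i j → trans (entry-−outer (bordered b v S) x (suc i) (suc j))
                  (trans (cong (_xor (δ i ∧ δ j)) (entry-bordered-suc-suc b v S i j)) (sym (entry-−outer S δ i j))))
  where
  δ = λ i → lookup v i xor lookup w i
  x = true ∷ᶠ δ

AdjacencyClosed : (Mat n → Set) → Set
AdjacencyClosed {n} R = ∀ Q x → Nonzero x → R Q → R (Q -M outer x)

-- Induction on n: with the corner and first row fixed, the minors form the smaller instance, and
-- a step by x = (1, v + w) moves to any first row w while flipping the corner.
connected : (R : Mat n → Set) → AdjacencyClosed R → {P M : Mat n} → Sym P → Sym M → R P → R M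
connected {zero} R closed {[]} {[]} _ _ R-P = R-P
connected {suc n} R closed {P} {M} P-sym M-sym R-P =
  subst R (sym (bordered-decomposition M M-sym)) (fill (reach (entry M zero zero) (firstRow M) start))
  where
  Reached : Bool → Vec Bool n → Set
  Reached b v = Σ[ S ∈ Mat n ] Sym S × R (bordered b v S)

  start : Reached (entry P zero zero) (firstRow P)
  start = minor P , Sym-minor {M = P} P-sym , subst R (bordered-decomposition P P-sym) R-P

  flip : ∀ {b v} w → Reached b v → Reached (not b) w
  flip {b} {v} w (S , S-sym , R-S) =
    S -M outer δ , Sym-−M {M = S} S-sym (Sym-outer δ) ,
    subst R (bordered-−outer-true b v w S) (closed (bordered b v S) (true ∷ᶠ δ) (zero , refl) R-S)
    where
    δ = λ i → lookup v i xor lookup w i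

  reach : ∀ c w {b v} → Reached b v → Reached c w
  reach false w {true} = flip w
  reach true w {false} = flip w
  reach false w {false} = flip w ∘ flip w
  reach true w {true} = flip w ∘ flip w

  fill : ∀ {c w} → Reached c w → R (bordered c w (minor M))
  fill {c} {w} (S , S-sym , R-S) =
    connected (λ S → R (bordered c w S)) closed-minor S-sym (Sym-minor {M = M} M-sym) R-S
    where
    closed-minor : AdjacencyClosed (λ S → R (bordered c w S))
    closed-minor Q y (i , yᵢ) R-Q =
      subst R (bordered-−outer-false c w Q y) (closed (bordered c w Q) (false ∷ᶠ y) (suc i , yᵢ) R-Q)

-- Counting the points

symmetricMatrices : (n : ℕ) → List (Mat n)
symmetricMatrices zero = [] ∷ []
symmetricMatrices (suc n) =
  cartesianProductWith (uncurry ∘ bordered) bools (cartesianProduct (allVecs bools n) (symmetricMatrices n))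

symmetricMatrices-unique : (n : ℕ) → Unique (symmetricMatrices n)
symmetricMatrices-unique zero = [] ∷ []
symmetricMatrices-unique (suc n) = Unique.cartesianProductWith⁺ (uncurry ∘ bordered) bordered-injective
  bools-unique (Unique.cartesianProduct⁺ (allVecs-unique n bools-unique) (symmetricMatrices-unique n))
  where
  bordered-injective : ∀ {b c} {vS wT : Vec Bool n × Mat n} →
    uncurry (bordered b) vS ≡ uncurry (bordered c) wT → b ≡ c × vS ≡ wT
  bordered-injective {b} {c} {v , S} {w , T} eq =
    let b≡c , v≡w = ∷-injective (cong (λ M → lookup M zero) eq) in
    b≡c , cong₂ _,_ v≡w (trans (sym (minor-bordered b v S)) (trans (cong minor eq) (minor-bordered c w T)))

∈-symmetricMatrices : (M : Mat n) → M ∈ symmetricMatrices n ⇔ Sym M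
∈-symmetricMatrices {zero} [] = mk⇔ (λ _ ()) (λ _ → here refl)
∈-symmetricMatrices {suc n} M = mk⇔ sound complete
  where
  rowsAndMinors = cartesianProduct (allVecs bools n) (symmetricMatrices n)
  sound : M ∈ symmetricMatrices (suc n) → Sym M
  sound M∈ with ∈-cartesianProductWith⁻ (uncurry ∘ bordered) bools rowsAndMinors M∈
  ... | b , (v , S) , _ , vS∈ , refl =
    Sym-bordered b v (to (∈-symmetricMatrices S) (proj₂ (∈-cartesianProduct⁻ (allVecs bools n) _ vS∈)))
  complete : Sym M → M ∈ symmetricMatrices (suc n)
  complete M-sym = subst (_∈ symmetricMatrices (suc n)) (sym (bordered-decomposition M M-sym))
    (∈-cartesianProductWith⁺ (uncurry ∘ bordered) (∈-bools _)
      (∈-cartesianProduct⁺ (∈-allVecs ∈-bools (firstRow M))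
                           (from (∈-symmetricMatrices (minor M)) (Sym-minor {M = M} M-sym))))

triangular : ℕ → ℕ
triangular zero = 0
triangular (suc n) = suc n + triangular n

length-symmetricMatrices : (n : ℕ) → length (symmetricMatrices n) ≡ 2 ^ triangular n
length-symmetricMatrices zero = refl
length-symmetricMatrices (suc n) = begin
  length (symmetricMatrices (suc n))
    ≡⟨ length-cartesianProductWith (uncurry ∘ bordered) bools rowsAndMinors ⟩
  2 * length rowsAndMinors
    ≡⟨ cong (2 *_) (length-cartesianProductWith _,_ (allVecs bools n) (symmetricMatrices n)) ⟩
  2 * (length (allVecs bools n) * length (symmetricMatrices n))
    ≡⟨ cong (2 *_) (cong₂ _*_ (length-allVecs bools n) (length-symmetricMatrices n)) ⟩
  2 * (2 ^ n * 2 ^ triangular n)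
    ≡⟨ cong (2 *_) (^-distribˡ-+-* 2 n (triangular n)) ⟨
  2 ^ triangular (suc n) ∎
  where
  open ≡-Reasoning
  rowsAndMinors = cartesianProduct (allVecs bools n) (symmetricMatrices n)

triangular-half : (n : ℕ) → n * (n + 1) / 2 ≡ triangular n
triangular-half n = trans (cong (_/ 2) (sym (double n))) (m*n/n≡m (triangular n) 2)
  where
  open +-*-Solver
  double : ∀ n → triangular n * 2 ≡ n * (n + 1)
  double zero = refl
  double (suc n) = begin
    (suc n + triangular n) * 2        ≡⟨ *-distribʳ-+ 2 (suc n) (triangular n) ⟩
    suc n * 2 + triangular n * 2      ≡⟨ cong (suc n * 2 +_) (double n) ⟩
    suc n * 2 + n * (n + 1)           ≡⟨ solve 1 (λ n → (con 1 :+ n) :* con 2 :+ n :* (n :+ con 1)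
                                                  := (con 1 :+ n) :* ((con 1 :+ n) :+ con 1)) refl n ⟩
    suc n * (suc n + 1)               ∎
    where open ≡-Reasoning

size-≡-#points : (c : Subset n) → (∀ M → Sym M → T (c M)) → size c ≡ 2 ^ (n * (n + 1) / 2)
size-≡-#points {n} c everywhere = begin
  size c                          ≡⟨ size-≡-length c (symmetricMatrices-unique n) (mk⇔ listed⇒member member⇒listed) ⟩
  length (symmetricMatrices n)    ≡⟨ length-symmetricMatrices n ⟩
  2 ^ triangular n                ≡⟨ cong (2 ^_) (triangular-half n) ⟨
  2 ^ (n * (n + 1) / 2)           ∎
  where
  open ≡-Reasoning
  listed⇒member : ∀ {M} → M ∈ symmetricMatrices n → Member c M
  listed⇒member {M} M∈ =
    let M-sym = to (∈-symmetricMatrices M) M∈ in mkMember {c = c} {M} M-sym (everywhere M M-sym)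
  member⇒listed : ∀ {M} → Member c M → M ∈ symmetricMatrices n
  member⇒listed {M} M∈ = from (∈-symmetricMatrices M) (member⇒Sym {c = c} {M} M∈)

nonempty-stoppingSet-size : {S : Subset n} → IsStoppingSet S → 0 < size S →
  size S ≡ 2 ^ (n * (n + 1) / 2)
nonempty-stoppingSet-size {S = S} S-stop 0<size with positive-size⇒member S 0<size
... | P , P∈ = size-≡-#points S λ M M-sym →
  member⇒T {c = S} {M} (connected (Member S) closed (member⇒Sym {c = S} {P} P∈) M-sym P∈)
  where
  closed : AdjacencyClosed (Member S)
  closed Q x x≢0 Q∈ = stoppingSet-adjacent S-stop
    (Sym-−M {M = Q} (member⇒Sym {c = S} {Q} Q∈) (Sym-outer x)) (adjacent-outer Q x≢0) Q∈

theorem6 : (n : ℕ) → 1 ≤ n →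
    MinDistance n (2 ^ ((n * (n + 1)) / 2)) × StoppingDistance n (2 ^ ((n * (n + 1)) / 2))
theorem6 (suc m) _ =
  ((full , full-isCodeword , full-nonempty , size-full) , λ c c∈C c≢0 → ≥-bound (codeword⇒stoppingSet c∈C) c≢0) ,
  ((full , full-isStoppingSet , full-nonempty , size-full) , λ S S-stop S≢∅ → ≥-bound S-stop S≢∅)
  where
  size-full : size (full {suc m}) ≡ 2 ^ (suc m * (suc m + 1) / 2)
  size-full = size-≡-#points {suc m} full λ _ _ → _
  full-nonempty : 0 < size (full {suc m})
  full-nonempty = subst (0 <_) (sym size-full) (m^n>0 2 (suc m * (suc m + 1) / 2))
  ≥-bound : {S : Subset (suc m)} → IsStoppingSet S → 0 < size S → 2 ^ (suc m * (suc m + 1) / 2) ≤ size S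
  ≥-bound S-stop S≢∅ = ≤-reflexive (sym (nonempty-stoppingSet-size S-stop S≢∅))
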